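{- Let $G$ be a finite simple graph with vertex set $V(G)=\{v_1,\dots,v_k,\dots,v_n\}$, where $1<k<n$. Suppose that (1) $\bigcup_{i=1}^{k}N[v_i]=V(G)$; (2) $N[v_1]\cap \bigcup_{i=2}^{k}N[v_i]=\emptyset$; (3) $|d(v_i)-d(v_j)|\neq 1$ for every $i\in\{1,\dots,k\}$ and every $j\in\{1,\dots,n\}\setminus\{i\}$; (4) $\{v\in V(G)\mid d(v)=d(v_1)\}=\{v_1\}$; and (5) $\{v\in V(G)\mid d(v)=d(v_i)\}\subseteq\{v_2,\dots,v_k\}$ for every $i\in\{2,\dots,k\}$. Then $G$ is reconstructible.
   Context: All graphs are finite and simple. For a graph $G$ and $v\in V(G)$, $N(v)=\{u\in V(G)\mid uv\in E(G)\}$ is the open neighbourhood, $N[v]=N(v)\cup\{v\}$ the closed neighbourhood, and $d(v)=|N(v)|$ the degree of $v$ in $G$. $G-v$ denotes the graph obtained from $G$ by deleting $v$ and all edges incident to it. A graph $G$ with $V(G)=\{v_1,\dots,v_n\}$ is reconstructible if every graph $G'$ with $V(G')=\{v'_1,\dots,v'_n\}$ such that $G-v_j\cong G'-v'_j$ for every $j\in\{1,\dots,n\}$ is isomorphic to $G$. -}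

module Defs where

open import Data.Nat using (ℕ; zero; suc; _+_; _<_; _≤_; ∣_-_∣)
open import Data.Fin using (Fin; zero; suc; toℕ; punchIn)
open import Data.Bool using (Bool; true; false; if_then_else_)
open import Data.Product using (Σ; ∃; _×_; _,_)
open import Data.Sum using (_⊎_)
open import Function.Bundles using (_↔_; Inverse)
open import Relation.Binary.PropositionalEquality using (_≡_)
open import Relation.Nullary using (¬_)

-- A finite simple graph on vertex set Fin n (vertex v_{i+1} is the element i).
record Graph (n : ℕ) : Set where
  field
    adj     : Fin n → Fin n → Bool
    sym     : ∀ u v → adj u v ≡ adj v u
    irrefl  : ∀ v → adj v v ≡ false
open Graph public

countTrue : ∀ {n} → (Fin n → Bool) → ℕ
countTrue {zero}  p = 0
countTrue {suc n} p = (if p zero then 1 else 0) + countTrue (λ i → p (suc i))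

deg : ∀ {n} → Graph n → Fin n → ℕ
deg G v = countTrue (adj G v)

N[_]_∋_ : ∀ {n} → Graph n → Fin n → Fin n → Set
N[ G ] v ∋ u = (u ≡ v) ⊎ (adj G v u ≡ true)

delete : ∀ {m} → Graph (suc m) → Fin (suc m) → Graph m
delete {m} G v = record
  { adj    = λ i j → adj G (punchIn v i) (punchIn v j)
  ; sym    = λ i j → sym G (punchIn v i) (punchIn v j)
  ; irrefl = λ i → irrefl G (punchIn v i)
  }

_≅_ : ∀ {m} → Graph m → Graph m → Set
_≅_ {m} G H = Σ (Fin m ↔ Fin m) λ f →
  ∀ x y → adj G x y ≡ adj H (Inverse.to f x) (Inverse.to f y)

Reconstructible : ∀ {m} → Graph (suc m) → Set
Reconstructible {m} G = (G' : Graph (suc m)) →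
  (∀ j → delete G j ≅ delete G' j) → G ≅ G'

{-# OPTIONS --safe #-}

-- Counting degree sums over the cards shows that a graph G' hypomorphic to G has the degrees
-- of G.  In the card G - u a vertex a has degree d(a) - [a ~ u], so its image b in G' - u has
-- d(b) = d(a) - [a ~ u] + [b ~ u]; when no degree lies at distance one from d(a), as (3) says
-- for v₁,…,v_k, this forces d(b) = d(a) and b ~ u iff a ~ u.  With (4) and (5), which
-- recognise v₁ and {v₂,…,v_k} by their degrees, this transports (1) and (2) to G' and shows
-- that an isomorphism G - v₁ ≅ G' - v₁ maps {v₂,…,v_k} into itself.  By (1) and (2),
-- N(v₁) is the set of vertices outside N[v₂] ∪ … ∪ N[v_k], which is visible in G - v₁; hence
-- that isomorphism extends to G ≅ G' by v₁ ↦ v₁.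

module Submission where

open import Defs hiding (sym)
open import Data.Bool using (Bool; true; false; if_then_else_)
open import Data.Bool.Properties using (⇔→≡)
open import Data.Fin using (Fin; zero; suc; toℕ; punchIn; punchOut; _≟_)
open import Data.Fin.Permutation using (lift₀)
open import Data.Fin.Properties using (punchIn-punchOut; suc-injective)
open import Data.Nat using (ℕ; zero; suc; _+_; _*_; _<_; _≤_; ∣_-_∣; z≤n; s≤s; s≤s⁻¹)
open import Data.Nat.Properties
  using (+-comm; +-cancelˡ-≡; +-cancelʳ-≡; *-cancelˡ-≡; *-distribʳ-+;
         <⇒≤; ≤-trans; 0≢1+n; ∣n-n∣≡0; ∣m+n-m+o∣≡∣n-o∣; +-*-semiring)
open import Algebra.Properties.Semiring.Sum +-*-semiring
  using (sum; sum-cong-≗; sum-remove; ∑-permute; ∑-distrib-+; *-distribˡ-sum)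
open import Data.Product using (Σ; _×_; _,_; proj₁; proj₂)
open import Data.Sum using (inj₁; inj₂)
open import Function using (_∘_)
open import Function.Bundles using (Inverse; _↔_; mk⇔)
open import Function.Properties.Inverse using (↔-sym)
open import Relation.Binary.PropositionalEquality
  using (_≡_; _≢_; _≗_; refl; sym; trans; cong; cong₂; subst; module ≡-Reasoning)
open import Relation.Nullary using (¬_; yes; no; contradiction)
open import Data.Nat.Solver using (module +-*-Solver)
open +-*-Solver using (solve; _:+_; _:*_; _:=_; con)

open Inverse using (to; from; strictlyInverseˡ; strictlyInverseʳ)

indicator : Bool → ℕ
indicator b = if b then 1 else 0

∣indicator-indicator∣≢1⇒≡ : ∀ {x y} → ∣ indicator x - indicator y ∣ ≢ 1 → x ≡ y
∣indicator-indicator∣≢1⇒≡ {true}  {true}  _  = refl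
∣indicator-indicator∣≢1⇒≡ {true}  {false} ≢1 = contradiction refl ≢1
∣indicator-indicator∣≢1⇒≡ {false} {true}  ≢1 = contradiction refl ≢1
∣indicator-indicator∣≢1⇒≡ {false} {false} _  = refl

countTrue≡sum : ∀ {n} (p : Fin n → Bool) → countTrue p ≡ sum (indicator ∘ p)
countTrue≡sum {zero}  p = refl
countTrue≡sum {suc n} p = cong (indicator (p zero) +_) (countTrue≡sum (p ∘ suc))

countTrue-cong : ∀ {n} {p q : Fin n → Bool} → p ≗ q → countTrue p ≡ countTrue q
countTrue-cong {zero}  p≗q = refl
countTrue-cong {suc n} p≗q = cong₂ (λ b c → indicator b + c) (p≗q zero) (countTrue-cong (p≗q ∘ suc))

countTrue-permute : ∀ {n} (p : Fin n → Bool) (π : Fin n ↔ Fin n) → countTrue (p ∘ to π) ≡ countTrue p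
countTrue-permute p π = begin
  countTrue (p ∘ to π)       ≡⟨ countTrue≡sum (p ∘ to π) ⟩
  sum (indicator ∘ p ∘ to π) ≡⟨ ∑-permute (indicator ∘ p) π ⟨
  sum (indicator ∘ p)        ≡⟨ countTrue≡sum p ⟨
  countTrue p                ∎
  where open ≡-Reasoning

countTrue-punchIn : ∀ {n} (p : Fin (suc n) → Bool) w →
                    countTrue p ≡ indicator (p w) + countTrue (p ∘ punchIn w)
countTrue-punchIn p w = begin
  countTrue p                                       ≡⟨ countTrue≡sum p ⟩
  sum (indicator ∘ p)                               ≡⟨ sum-remove {i = w} (indicator ∘ p) ⟩
  indicator (p w) + sum (indicator ∘ p ∘ punchIn w)
    ≡⟨ cong (indicator (p w) +_) (countTrue≡sum (p ∘ punchIn w)) ⟨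
  indicator (p w) + countTrue (p ∘ punchIn w)       ∎
  where open ≡-Reasoning

sum-const : ∀ n c → sum {n} (λ _ → c) ≡ n * c
sum-const zero    c = refl
sum-const (suc n) c = cong (c +_) (sum-const n c)

degreeSum : ∀ {n} → Graph n → ℕ
degreeSum H = sum (deg H)

module _ {n} (G H : Graph n) where

  ≅-sym : G ≅ H → H ≅ G
  ≅-sym (φ , preserves) = ↔-sym φ , λ x y →
    sym (trans (preserves (from φ x) (from φ y)) (cong₂ (adj H) (strictlyInverseˡ φ x) (strictlyInverseˡ φ y)))

  deg-≅ : ((φ , _) : G ≅ H) → ∀ x → deg H (to φ x) ≡ deg G x
  deg-≅ (φ , preserves) x =
    trans (sym (countTrue-permute (adj H (to φ x)) φ)) (sym (countTrue-cong (preserves x)))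

  N[]-≅ : ((φ , _) : G ≅ H) → ∀ {v u} → N[ G ] v ∋ u → N[ H ] to φ v ∋ to φ u
  N[]-≅ (φ , preserves) (inj₁ u≡v)          = inj₁ (cong (to φ) u≡v)
  N[]-≅ (φ , preserves) {v} {u} (inj₂ v~u) = inj₂ (trans (sym (preserves v u)) v~u)

  degreeSum-≅ : G ≅ H → degreeSum H ≡ degreeSum G
  degreeSum-≅ iso@(φ , _) = trans (∑-permute (deg H) φ) (sum-cong-≗ (deg-≅ iso))

adjacent⇒≢ : ∀ {n} (H : Graph n) {a u} → adj H a u ≡ true → u ≢ a
adjacent⇒≢ H {a} a~a refl with () ← trans (sym a~a) (irrefl H a)

punchIn-onto : ∀ {m} {u a : Fin (suc m)} → u ≢ a → Σ (Fin m) λ i → punchIn u i ≡ a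
punchIn-onto u≢a = punchOut u≢a , punchIn-punchOut u≢a

deg-punchIn : ∀ {m} (H : Graph (suc m)) w i →
              deg H (punchIn w i) ≡ deg (delete H w) i + indicator (adj H (punchIn w i) w)
deg-punchIn H w i =
  trans (countTrue-punchIn (adj H (punchIn w i)) w) (+-comm (indicator (adj H (punchIn w i) w)) _)

deg≡sum-punchIn : ∀ {m} (H : Graph (suc m)) w → deg H w ≡ sum (λ i → indicator (adj H (punchIn w i) w))
deg≡sum-punchIn H w = begin
  deg H w
    ≡⟨ countTrue-punchIn (adj H w) w ⟩
  indicator (adj H w w) + countTrue (adj H w ∘ punchIn w)
    ≡⟨ cong (λ b → indicator b + countTrue (adj H w ∘ punchIn w)) (irrefl H w) ⟩
  countTrue (adj H w ∘ punchIn w)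
    ≡⟨ countTrue≡sum (adj H w ∘ punchIn w) ⟩
  sum (λ i → indicator (adj H w (punchIn w i)))
    ≡⟨ sum-cong-≗ (cong indicator ∘ Graph.sym H w ∘ punchIn w) ⟩
  sum (λ i → indicator (adj H (punchIn w i) w))
    ∎
  where open ≡-Reasoning

degreeSum-delete : ∀ {m} (H : Graph (suc m)) w → degreeSum H ≡ 2 * deg H w + degreeSum (delete H w)
degreeSum-delete H w = begin
  degreeSum H
    ≡⟨ sum-remove {i = w} (deg H) ⟩
  deg H w + sum (deg H ∘ punchIn w)
    ≡⟨ cong (deg H w +_) (sum-cong-≗ (deg-punchIn H w)) ⟩
  deg H w + sum (λ i → deg (delete H w) i + indicator (adj H (punchIn w i) w))
    ≡⟨ cong (deg H w +_) (∑-distrib-+ (deg (delete H w)) _) ⟩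
  deg H w + (degreeSum (delete H w) + sum (λ i → indicator (adj H (punchIn w i) w)))
    ≡⟨ cong (λ s → deg H w + (degreeSum (delete H w) + s)) (deg≡sum-punchIn H w) ⟨
  deg H w + (degreeSum (delete H w) + deg H w)
    ≡⟨ solve 2 (λ a b → a :+ (b :+ a) := con 2 :* a :+ b) refl (deg H w) _ ⟩
  2 * deg H w + degreeSum (delete H w)
    ∎
  where open ≡-Reasoning

sum-degreeSum-delete : ∀ {r} (H : Graph (2 + r)) → sum (λ w → degreeSum (delete H w)) ≡ r * degreeSum H
sum-degreeSum-delete {r} H = +-cancelˡ-≡ (2 * degreeSum H) _ _ (begin
  2 * degreeSum H + sum (λ w → degreeSum (delete H w))
    ≡⟨ cong (_+ sum (λ w → degreeSum (delete H w))) (*-distribˡ-sum 2 (deg H)) ⟩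
  sum (λ w → 2 * deg H w) + sum (λ w → degreeSum (delete H w))
    ≡⟨ ∑-distrib-+ (λ w → 2 * deg H w) (λ w → degreeSum (delete H w)) ⟨
  sum (λ w → 2 * deg H w + degreeSum (delete H w))    ≡⟨ sum-cong-≗ (degreeSum-delete H) ⟨
  sum {2 + r} (λ _ → degreeSum H)                     ≡⟨ sum-const (2 + r) (degreeSum H) ⟩
  (2 + r) * degreeSum H                               ≡⟨ *-distribʳ-+ (degreeSum H) 2 r ⟩
  2 * degreeSum H + r * degreeSum H                   ∎)
  where open ≡-Reasoning

Hypomorphic : ∀ {m} → Graph (suc m) → Graph (suc m) → Set
Hypomorphic G G' = ∀ j → delete G j ≅ delete G' j

Hypomorphic-sym : ∀ {m} (G G' : Graph (suc m)) → Hypomorphic G G' → Hypomorphic G' G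
Hypomorphic-sym G G' hyp j = ≅-sym (delete G j) (delete G' j) (hyp j)

degreeSum-hypomorphic : ∀ {r} (G G' : Graph (3 + r)) → Hypomorphic G G' → degreeSum G ≡ degreeSum G'
degreeSum-hypomorphic {r} G G' hyp = *-cancelˡ-≡ _ _ (suc r) (begin
  suc r * degreeSum G                  ≡⟨ sum-degreeSum-delete G ⟨
  sum (λ w → degreeSum (delete G w))   ≡⟨ sum-cong-≗ (λ w → degreeSum-≅ (delete G w) (delete G' w) (hyp w)) ⟨
  sum (λ w → degreeSum (delete G' w))  ≡⟨ sum-degreeSum-delete G' ⟩
  suc r * degreeSum G'                 ∎)
  where open ≡-Reasoning

-- For two vertices this fails: K₂ and its complement have the same cards.
deg-hypomorphic : ∀ {m} (G G' : Graph (suc m)) → 2 ≤ m → Hypomorphic G G' → deg G' ≗ deg G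
deg-hypomorphic {suc (suc r)} G G' (s≤s (s≤s z≤n)) hyp w =
  *-cancelˡ-≡ _ _ 2 (+-cancelʳ-≡ (degreeSum (delete G w)) _ _ (begin
    2 * deg G' w + degreeSum (delete G w)
      ≡⟨ cong (2 * deg G' w +_) (degreeSum-≅ (delete G w) (delete G' w) (hyp w)) ⟨
    2 * deg G' w + degreeSum (delete G' w)  ≡⟨ degreeSum-delete G' w ⟨
    degreeSum G'                            ≡⟨ degreeSum-hypomorphic G G' hyp ⟨
    degreeSum G                             ≡⟨ degreeSum-delete G w ⟩
    2 * deg G w + degreeSum (delete G w)    ∎))
  where open ≡-Reasoning

-- Both degrees are deg (delete H u) i plus an adjacency bit, and no degree is one away from d a.
card-preserves : ∀ {m} (H H' : Graph (suc m)) {d : Fin (suc m) → ℕ} → deg H ≗ d → deg H' ≗ d →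
  ∀ u (φ : delete H u ≅ delete H' u) i →
  let a = punchIn u i; b = punchIn u (to (proj₁ φ) i) in
  (∀ c → ∣ d a - d c ∣ ≢ 1) → adj H' b u ≡ adj H a u × d b ≡ d a
card-preserves H H' {d} degH degH' u φ i gap = adj≡ , d≡
  where
  a = punchIn u i
  b = punchIn u (to (proj₁ φ) i)
  c = deg (delete H u) i
  da : d a ≡ c + indicator (adj H a u)
  da = trans (sym (degH a)) (deg-punchIn H u i)
  db : d b ≡ c + indicator (adj H' b u)
  db = trans (sym (degH' b))
       (trans (deg-punchIn H' u _) (cong (_+ _) (deg-≅ (delete H u) (delete H' u) φ i)))
  adj≡ : adj H' b u ≡ adj H a u
  adj≡ = sym (∣indicator-indicator∣≢1⇒≡ λ ≡1 →
    gap b (trans (cong₂ ∣_-_∣ da db) (trans (∣m+n-m+o∣≡∣n-o∣ c _ _) ≡1)))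
  d≡ : d b ≡ d a
  d≡ = trans db (trans (cong (λ x → c + indicator x) adj≡) (sym da))

module _ {m} (H : Graph (suc m)) {t x : Fin m} where

  N[]-delete₀ : N[ H ] suc t ∋ suc x → N[ delete H zero ] t ∋ x
  N[]-delete₀ (inj₁ x≡t) = inj₁ (suc-injective x≡t)
  N[]-delete₀ (inj₂ t~x) = inj₂ t~x

  N[]-undelete₀ : N[ delete H zero ] t ∋ x → N[ H ] suc t ∋ suc x
  N[]-undelete₀ (inj₁ x≡t) = inj₁ (cong suc x≡t)
  N[]-undelete₀ (inj₂ t~x) = inj₂ t~x

≅-extend₀ : ∀ {m} (H H' : Graph (suc m)) ((π , _) : delete H zero ≅ delete H' zero) →
            (∀ x → adj H zero (suc x) ≡ adj H' zero (suc (to π x))) → H ≅ H'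
≅-extend₀ H H' (π , preserves) adj₀ = lift₀ π , preserves₀
  where
  preserves₀ : ∀ x y → adj H x y ≡ adj H' (to (lift₀ π) x) (to (lift₀ π) y)
  preserves₀ zero    zero    = trans (irrefl H zero) (sym (irrefl H' zero))
  preserves₀ zero    (suc y) = adj₀ y
  preserves₀ (suc x) zero    = trans (Graph.sym H (suc x) zero) (trans (adj₀ x) (Graph.sym H' zero _))
  preserves₀ (suc x) (suc y) = preserves x y

-- The parameters are conditions (3)–(5) on a degree sequence d; Admissible H says that H has
-- degrees d and satisfies (1) and (2).
module Conditions {m k : ℕ} (1<k : 1 < k) (d : Fin (suc m) → ℕ)
  (degree-gap : ∀ i → toℕ i < k → ∀ j → ¬ (j ≡ i) → ¬ (∣ d i - d j ∣ ≡ 1))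
  (v₁-unique : ∀ v → d v ≡ d zero → v ≡ zero)
  (inner-closed : ∀ i → 1 ≤ toℕ i → toℕ i < k → ∀ v → d v ≡ d i → 1 ≤ toℕ v × toℕ v < k) where

  ∣d-d∣≢1 : ∀ {i} → toℕ i < k → ∀ j → ∣ d i - d j ∣ ≢ 1
  ∣d-d∣≢1 {i} i<k j with j ≟ i
  ... | yes refl = λ ≡1 → 0≢1+n (trans (sym (∣n-n∣≡0 (d i))) ≡1)
  ... | no j≢i   = degree-gap i i<k j j≢i

  same-degree-<k : ∀ {i j} → toℕ i < k → d j ≡ d i → toℕ j < k
  same-degree-<k {zero}  {j} _   dj≡di with refl ← v₁-unique j dj≡di = <⇒≤ 1<k
  same-degree-<k {suc i} {j} i<k dj≡di = proj₂ (inner-closed (suc i) (s≤s z≤n) i<k j dj≡di)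

  N[]-transfer : ∀ H H' → deg H ≗ d → deg H' ≗ d → Hypomorphic H H' → ∀ {a u} → toℕ a < k →
                 N[ H ] a ∋ u → Σ (Fin (suc m)) λ b → d b ≡ d a × N[ H' ] b ∋ u
  N[]-transfer H H' degH degH' hyp a<k (inj₁ u≡a) = _ , refl , inj₁ u≡a
  N[]-transfer H H' degH degH' hyp {u = u} a<k (inj₂ a~u)
    with i , refl ← punchIn-onto (adjacent⇒≢ H a~u)
    = let adj≡ , d≡ = card-preserves H H' degH degH' u (hyp u) i (∣d-d∣≢1 a<k)
      in _ , d≡ , inj₂ (trans adj≡ a~u)

  record Admissible (H : Graph (suc m)) : Set where
    field
      degree     : deg H ≗ d
      dominating : ∀ u → Σ (Fin (suc m)) λ i → toℕ i < k × N[ H ] i ∋ u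
      separated  : ∀ u → N[ H ] zero ∋ u → ∀ i → 1 ≤ toℕ i → toℕ i < k → ¬ (N[ H ] i ∋ u)

  admissible-hypomorphic : ∀ {G G'} → Admissible G → deg G' ≗ d → Hypomorphic G G' → Admissible G'
  admissible-hypomorphic {G} {G'} adm degG' hyp = record
    { degree = degG' ; dominating = dominating' ; separated = separated' }
    where
    open Admissible adm
    hyp⁻¹ : Hypomorphic G' G
    hyp⁻¹ = Hypomorphic-sym G G' hyp
    dominating' : ∀ u → Σ (Fin (suc m)) λ i → toℕ i < k × N[ G' ] i ∋ u
    dominating' u =
      let i , i<k , u∈N[i] = dominating u
          b , db≡di , u∈N'[b] = N[]-transfer G G' degree degG' hyp i<k u∈N[i]
      in b , same-degree-<k i<k db≡di , u∈N'[b]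
    separated' : ∀ u → N[ G' ] zero ∋ u → ∀ i → 1 ≤ toℕ i → toℕ i < k → ¬ (N[ G' ] i ∋ u)
    separated' u u∈N'[v₁] i 1≤i i<k u∈N'[i]
      with b₀ , db₀ , u∈N[b₀] ← N[]-transfer G' G degG' degree hyp⁻¹ (<⇒≤ 1<k) u∈N'[v₁]
         | b , db , u∈N[b] ← N[]-transfer G' G degG' degree hyp⁻¹ i<k u∈N'[i]
      with refl ← v₁-unique b₀ db₀
      = let 1≤b , b<k = inner-closed i 1≤i i<k b db in separated u u∈N[b₀] b 1≤b b<k u∈N[b]

  -- Vertex t of the card H - v₁ is v_{t+2}.
  InnerDominated : Graph m → Fin m → Set
  InnerDominated K x = Σ (Fin m) λ t → toℕ (suc t) < k × N[ K ] t ∋ x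

  InnerDominated-≅ : ∀ H H' → deg H ≗ d → deg H' ≗ d → ((π , _) : delete H zero ≅ delete H' zero) →
                     ∀ {x} → InnerDominated (delete H zero) x → InnerDominated (delete H' zero) (to π x)
  InnerDominated-≅ H H' degH degH' φ@(π , _) (t , t<k , x∈N[t]) =
    to π t , same-degree-<k t<k (proj₂ (card-preserves H H' degH degH' zero φ t (∣d-d∣≢1 t<k))) ,
    N[]-≅ (delete H zero) (delete H' zero) φ x∈N[t]

  module _ {H} (adm : Admissible H) where
    open Admissible adm

    adjacent₀⇒¬InnerDominated : ∀ {x} → adj H zero (suc x) ≡ true → ¬ InnerDominated (delete H zero) x
    adjacent₀⇒¬InnerDominated {x} v₁~x (t , t<k , x∈N[t]) =
      separated (suc x) (inj₂ v₁~x) (suc t) (s≤s z≤n) t<k (N[]-undelete₀ H x∈N[t])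

    ¬InnerDominated⇒adjacent₀ : ∀ {x} → ¬ InnerDominated (delete H zero) x → adj H zero (suc x) ≡ true
    ¬InnerDominated⇒adjacent₀ {x} ¬dom with dominating (suc x)
    ... | zero  , _   , inj₂ v₁~x = v₁~x
    ... | suc t , t<k , x∈N[t]    = contradiction (t , t<k , N[]-delete₀ H x∈N[t]) ¬dom

  adjacent₀-≅ : ∀ {H H'} → Admissible H → Admissible H' → ((π , _) : delete H zero ≅ delete H' zero) →
                ∀ x → adj H zero (suc x) ≡ adj H' zero (suc (to π x))
  adjacent₀-≅ {H} {H'} adm adm' φ@(π , _) x = ⇔→≡ (mk⇔
    (λ v₁~x  → ¬InnerDominated⇒adjacent₀ adm' (adjacent₀⇒¬InnerDominated adm v₁~x ∘ pull))
    (λ v₁~πx → ¬InnerDominated⇒adjacent₀ adm (adjacent₀⇒¬InnerDominated adm' v₁~πx ∘ push)))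
    where
    open Admissible using (degree)
    push : InnerDominated (delete H zero) x → InnerDominated (delete H' zero) (to π x)
    push = InnerDominated-≅ H H' (degree adm) (degree adm') φ
    pull : InnerDominated (delete H' zero) (to π x) → InnerDominated (delete H zero) x
    pull = subst (InnerDominated (delete H zero)) (strictlyInverseʳ π x)
         ∘ InnerDominated-≅ H' H (degree adm') (degree adm) (≅-sym (delete H zero) (delete H' zero) φ)

mainTheorem1 : (m k : ℕ) → 1 < k → k < suc m → (G : Graph (suc m)) →
    (∀ u → Σ (Fin (suc m)) λ i → toℕ i < k × N[ G ] i ∋ u) →
    (∀ u → N[ G ] zero ∋ u → ∀ i → 1 ≤ toℕ i → toℕ i < k → ¬ (N[ G ] i ∋ u)) →
    (∀ i → toℕ i < k → ∀ j → ¬ (j ≡ i) → ¬ (∣ deg G i - deg G j ∣ ≡ 1)) →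
    (∀ v → deg G v ≡ deg G zero → v ≡ zero) →
    (∀ i → 1 ≤ toℕ i → toℕ i < k → ∀ v → deg G v ≡ deg G i → 1 ≤ toℕ v × toℕ v < k) →
    Reconstructible G
mainTheorem1 m k 1<k k<n G dominating separated degree-gap v₁-unique inner-closed G' hyp =
  ≅-extend₀ G G' (hyp zero) (adjacent₀-≅ admissible admissible' (hyp zero))
  where
  open Conditions 1<k (deg G) degree-gap v₁-unique inner-closed
  admissible : Admissible G
  admissible = record { degree = λ _ → refl ; dominating = dominating ; separated = separated }
  admissible' : Admissible G'
  admissible' =
    admissible-hypomorphic admissible (deg-hypomorphic G G' (≤-trans 1<k (s≤s⁻¹ k<n)) hyp) hyp
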